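{- For finite sets of propositional formulas $\Gamma,\Delta$, the sequent $\Gamma\Rightarrow\bigvee\Delta$ is derivable in GP if and only if the sequent $\Gamma\Rightarrow\Delta$ is derivable in GPM.
   Context: Propositional formulas are built from propositional atoms and $\top$ using $\wedge,\vee,\rightarrow$. $\bigvee\Delta$ denotes the disjunction of the formulas of $\Delta$. GPM (multiple-conclusion propositional primal logic): sequents $\Gamma\Rightarrow\Delta$ with $\Gamma,\Delta$ finite sets of formulas; axioms $\phi\Rightarrow\phi$, $\Rightarrow\top$; rules: ($\wedge$L) $\Gamma,\phi,\psi\Rightarrow\Delta$ / $\Gamma,\phi\wedge\psi\Rightarrow\Delta$; ($\wedge$R) $\Gamma\Rightarrow\Delta,\phi$ and $\Gamma\Rightarrow\Delta,\psi$ / $\Gamma\Rightarrow\Delta,\phi\wedge\psi$; ($\vee$L) $\Gamma,\phi\Rightarrow\Delta$ and $\Gamma,\psi\Rightarrow\Delta$ / $\Gamma,\phi\vee\psi\Rightarrow\Delta$; ($\vee$R) $\Gamma\Rightarrow\Delta,\phi,\psi$ / $\Gamma\Rightarrow\Delta,\phi\vee\psi$; ($\rightarrow$L) $\Gamma,\psi\Rightarrow\Delta$ and $\Gamma\Rightarrow\Delta,\phi$ / $\Gamma,\phi\rightarrow\psi\Rightarrow\Delta$; ($\rightarrow$Rp) $\Gamma\Rightarrow\psi,\Delta$ / $\Gamma\Rightarrow\phi\rightarrow\psi,\Delta$; (Weakening) $\Gamma\Rightarrow\Delta$ / $\Gamma,\Gamma_1\Rightarrow\Delta,\Delta_1$;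 (Cut) $\Gamma\Rightarrow\Delta,\phi$ and $\phi,\Gamma_1\Rightarrow\Delta_1$ / $\Gamma,\Gamma_1\Rightarrow\Delta,\Delta_1$. GP (single-conclusion propositional primal logic): sequents $\Gamma\Rightarrow\theta$ with exactly one formula $\theta$ in the succedent; axioms $\phi\Rightarrow\phi$, $\Rightarrow\top$; rules: ($\wedge$L) $\Gamma,\phi,\psi\Rightarrow\theta$ / $\Gamma,\phi\wedge\psi\Rightarrow\theta$; ($\wedge$R) $\Gamma\Rightarrow\phi$ and $\Gamma\Rightarrow\psi$ / $\Gamma\Rightarrow\phi\wedge\psi$; ($\vee$L) $\Gamma,\phi\Rightarrow\theta$ and $\Gamma,\psi\Rightarrow\theta$ / $\Gamma,\phi\vee\psi\Rightarrow\theta$; ($\vee$R) $\Gamma\Rightarrow\phi_i$ / $\Gamma\Rightarrow\phi_1\vee\phi_2$ ($i=1,2$); ($\rightarrow$L) $\Gamma,\psi\Rightarrow\theta$ and $\Gamma\Rightarrow\phi$ / $\Gamma,\phi\rightarrow\psi\Rightarrow\theta$; ($\rightarrow$Rp) $\Gamma\Rightarrow\psi$ / $\Gamma\Rightarrow\phi\rightarrow\psi$; (Weakening) $\Gamma\Rightarrow\theta$ / $\Gamma,\Gamma_1\Rightarrow\theta$; (Cut) $\Gamma\Rightarrow\phi$ and $\phi,\Gamma_1\Rightarrow\theta$ / $\Gamma,\Gamma_1\Rightarrow\theta$. -}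

module Defs where

open import Data.Nat using (ℕ)
open import Data.List using (List; []; _∷_; _++_)
open import Data.List.Relation.Binary.Subset.Propositional using (_⊆_)

data Formula : Set where
  atom : ℕ → Formula
  ⊤'   : Formula
  _∧'_ : Formula → Formula → Formula
  _∨'_ : Formula → Formula → Formula
  _⇒'_ : Formula → Formula → Formula

infixr 6 _∧'_
infixr 5 _∨'_
infixr 4 _⇒'_

-- Finite sets of formulas are represented by lists; two lists denote the
-- same set when each is included in the other.
_≈ₛ_ : List Formula → List Formula → Set
Γ ≈ₛ Γ' = (Γ ⊆ Γ') × (Γ' ⊆ Γ)
  where open import Data.Product using (_×_)

⋁ : Formula → List Formula → Formula
⋁ φ []       = φ
⋁ φ (ψ ∷ Δ)  = φ ∨' ⋁ ψ Δ

infix 2 _⊢M_ _⊢P_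

-- GPM: multiple-conclusion propositional primal logic.
-- "Γ , φ" is rendered φ ∷ Γ and "Γ , Γ₁" as Γ ++ Γ₁; rule `setM` closes
-- derivability under equality of the underlying finite sets.
data _⊢M_ : List Formula → List Formula → Set where
  axM   : ∀ {φ} → (φ ∷ []) ⊢M (φ ∷ [])
  ⊤M    : [] ⊢M (⊤' ∷ [])
  ∧LM   : ∀ {Γ Δ φ ψ} → (φ ∷ ψ ∷ Γ) ⊢M Δ → ((φ ∧' ψ) ∷ Γ) ⊢M Δ
  ∧RM   : ∀ {Γ Δ φ ψ} → Γ ⊢M (φ ∷ Δ) → Γ ⊢M (ψ ∷ Δ) → Γ ⊢M ((φ ∧' ψ) ∷ Δ)
  ∨LM   : ∀ {Γ Δ φ ψ} → (φ ∷ Γ) ⊢M Δ → (ψ ∷ Γ) ⊢M Δ → ((φ ∨' ψ) ∷ Γ) ⊢M Δ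
  ∨RM   : ∀ {Γ Δ φ ψ} → Γ ⊢M (φ ∷ ψ ∷ Δ) → Γ ⊢M ((φ ∨' ψ) ∷ Δ)
  ⇒LM   : ∀ {Γ Δ φ ψ} → (ψ ∷ Γ) ⊢M Δ → Γ ⊢M (φ ∷ Δ) → ((φ ⇒' ψ) ∷ Γ) ⊢M Δ
  ⇒RpM  : ∀ {Γ Δ φ ψ} → Γ ⊢M (ψ ∷ Δ) → Γ ⊢M ((φ ⇒' ψ) ∷ Δ)
  weakM : ∀ {Γ Δ Γ₁ Δ₁} → Γ ⊢M Δ → (Γ ++ Γ₁) ⊢M (Δ ++ Δ₁)
  cutM  : ∀ {Γ Δ Γ₁ Δ₁ φ} → Γ ⊢M (φ ∷ Δ) → (φ ∷ Γ₁) ⊢M Δ₁ → (Γ ++ Γ₁) ⊢M (Δ ++ Δ₁)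
  setM  : ∀ {Γ Δ Γ' Δ'} → Γ ≈ₛ Γ' → Δ ≈ₛ Δ' → Γ ⊢M Δ → Γ' ⊢M Δ'

data _⊢P_ : List Formula → Formula → Set where
  axP   : ∀ {φ} → (φ ∷ []) ⊢P φ
  ⊤P    : [] ⊢P ⊤'
  ∧LP   : ∀ {Γ θ φ ψ} → (φ ∷ ψ ∷ Γ) ⊢P θ → ((φ ∧' ψ) ∷ Γ) ⊢P θ
  ∧RP   : ∀ {Γ φ ψ} → Γ ⊢P φ → Γ ⊢P ψ → Γ ⊢P (φ ∧' ψ)
  ∨LP   : ∀ {Γ θ φ ψ} → (φ ∷ Γ) ⊢P θ → (ψ ∷ Γ) ⊢P θ → ((φ ∨' ψ) ∷ Γ) ⊢P θ
  ∨R₁P  : ∀ {Γ φ ψ} → Γ ⊢P φ → Γ ⊢P (φ ∨' ψ)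
  ∨R₂P  : ∀ {Γ φ ψ} → Γ ⊢P ψ → Γ ⊢P (φ ∨' ψ)
  ⇒LP   : ∀ {Γ θ φ ψ} → (ψ ∷ Γ) ⊢P θ → Γ ⊢P φ → ((φ ⇒' ψ) ∷ Γ) ⊢P θ
  ⇒RpP  : ∀ {Γ φ ψ} → Γ ⊢P ψ → Γ ⊢P (φ ⇒' ψ)
  weakP : ∀ {Γ Γ₁ θ} → Γ ⊢P θ → (Γ ++ Γ₁) ⊢P θ
  cutP  : ∀ {Γ Γ₁ φ θ} → Γ ⊢P φ → (φ ∷ Γ₁) ⊢P θ → (Γ ++ Γ₁) ⊢P θ
  setP  : ∀ {Γ Γ' θ} → Γ ≈ₛ Γ' → Γ ⊢P θ → Γ' ⊢P θ

-- GP and GPM are linked by reading the succedent Δ of a GPM sequent as the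
-- disjunction ⋁Δ.  From GP to GPM, every GP rule is an instance of its GPM
-- counterpart (∨R₁/∨R₂ after weakening the succedent), and a final cut with
-- ⋁Δ ⇒ Δ unpacks the disjunction.  From GPM to GP, a succedent φ, Δ becomes
-- φ ∨ ⋁Δ, and φ is eliminated again by cutting on that disjunction and
-- closing the φ-branch with the rule being simulated.  Because GPM
-- succedents are sets, the induction proves ⋁ of every list containing Δ.
module Submission where

open import Defs
open import Data.List using (List; _∷_; []; _++_)
open import Data.List.Properties using (++-identityʳ)
open import Data.List.Membership.Propositional using (_∈_)
open import Data.List.Membership.Propositional.Properties using (∈-++⁻)
open import Data.List.Relation.Unary.Any using (here; there)
open import Data.List.Relation.Binary.Subset.Propositional using (_⊆_)
open import Data.List.Relation.Binary.Subset.Propositional.Properties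
  using (⊆-refl; ⊆-reflexive; ⊆-reflexive-↭; ∷⁺ʳ; xs⊆xs++ys; xs⊆ys++xs)
open import Data.List.Relation.Binary.Permutation.Propositional using (↭-refl; ↭-swap)
open import Data.Product using (_,_)
open import Data.Sum using ([_,_]′)
open import Function using (_∘_; id)
open import Function.Bundles using (_⇔_; mk⇔)
open import Relation.Binary.PropositionalEquality using (refl; sym)

≈ₛ-refl : {Γ : List Formula} → Γ ≈ₛ Γ
≈ₛ-refl = id , id

++-identityʳ-≈ₛ : (Γ : List Formula) → (Γ ++ []) ≈ₛ Γ
++-identityʳ-≈ₛ Γ = ⊆-reflexive (++-identityʳ Γ) , ⊆-reflexive (sym (++-identityʳ Γ))

++-absorbʳ-≈ₛ : {Γ Γ' : List Formula} → Γ ⊆ Γ' → (Γ ++ Γ') ≈ₛ Γ'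
++-absorbʳ-≈ₛ {Γ} Γ⊆Γ' = [ Γ⊆Γ' , id ]′ ∘ ∈-++⁻ Γ , xs⊆ys++xs _ Γ

swap-⊆ : {φ ψ : Formula} {Γ : List Formula} → (φ ∷ ψ ∷ Γ) ⊆ (ψ ∷ φ ∷ Γ)
swap-⊆ {φ} {ψ} = ⊆-reflexive-↭ (↭-swap φ ψ ↭-refl)

weakenP : ∀ {Γ Γ' θ} → Γ ⊆ Γ' → Γ ⊢P θ → Γ' ⊢P θ
weakenP {Γ' = Γ'} Γ⊆Γ' d = setP (++-absorbʳ-≈ₛ Γ⊆Γ') (weakP {Γ₁ = Γ'} d)

weakenM : ∀ {Γ Δ Γ' Δ'} → Γ ⊆ Γ' → Δ ⊆ Δ' → Γ ⊢M Δ → Γ' ⊢M Δ'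
weakenM {Γ' = Γ'} {Δ'} Γ⊆Γ' Δ⊆Δ' d =
  setM (++-absorbʳ-≈ₛ Γ⊆Γ') (++-absorbʳ-≈ₛ Δ⊆Δ') (weakM {Γ₁ = Γ'} {Δ₁ = Δ'} d)

assumptionP : ∀ {Γ φ} → φ ∈ Γ → Γ ⊢P φ
assumptionP φ∈Γ = weakenP (λ { (here refl) → φ∈Γ }) axP

cut-sameP : ∀ {Γ φ θ} → Γ ⊢P φ → (φ ∷ Γ) ⊢P θ → Γ ⊢P θ
cut-sameP d e = setP (++-absorbʳ-≈ₛ ⊆-refl) (cutP d e)

∨-absorbP : ∀ {Γ χ θ} → Γ ⊢P (χ ∨' θ) → (χ ∷ Γ) ⊢P θ → Γ ⊢P θ
∨-absorbP d e = cut-sameP d (∨LP e (assumptionP (here refl)))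

⋁-introP : ∀ {Γ χ δ Δ} → χ ∈ (δ ∷ Δ) → Γ ⊢P χ → Γ ⊢P ⋁ δ Δ
⋁-introP {Δ = []}    (here refl) d = d
⋁-introP {Δ = _ ∷ _} (here refl) d = ∨R₁P d
⋁-introP {Δ = _ ∷ _} (there χ∈) d = ∨R₂P (⋁-introP χ∈ d)

-- The GP reading of the GPM sequent Γ ⇒ Δ; quantifying over all lists that
-- contain Δ makes it invariant under GPM's weakening and set rules.
_⊢P⋁_ : List Formula → List Formula → Set
Γ ⊢P⋁ Δ = ∀ δ Δ' → Δ ⊆ (δ ∷ Δ') → Γ ⊢P ⋁ δ Δ'

⊢P⋁-weaken : ∀ {Γ Γ' Δ} → Γ ⊆ Γ' → Γ ⊢P⋁ Δ → Γ' ⊢P⋁ Δ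
⊢P⋁-weaken Γ⊆Γ' d δ Δ' s = weakenP Γ⊆Γ' (d δ Δ' s)

⊢P⋁-elim : ∀ {Γ φ Δ δ Δ'} → Γ ⊢P⋁ (φ ∷ Δ) → Δ ⊆ (δ ∷ Δ') →
           (φ ∷ Γ) ⊢P ⋁ δ Δ' → Γ ⊢P ⋁ δ Δ'
⊢P⋁-elim {φ = φ} {δ = δ} {Δ'} d s e = ∨-absorbP (d φ (δ ∷ Δ') (∷⁺ʳ φ s)) e

M⇒P : ∀ {Γ Δ} → Γ ⊢M Δ → Γ ⊢P⋁ Δ
M⇒P axM _ _ s = ⋁-introP (s (here refl)) axP
M⇒P ⊤M  _ _ s = ⋁-introP (s (here refl)) ⊤P
M⇒P (∧LM d) δ Δ' s = ∧LP (M⇒P d δ Δ' s)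
M⇒P (∧RM d e) _ _ s =
  ⊢P⋁-elim (M⇒P d) (s ∘ there)
    (⊢P⋁-elim (⊢P⋁-weaken there (M⇒P e)) (s ∘ there)
      (⋁-introP (s (here refl))
        (∧RP (assumptionP (there (here refl))) (assumptionP (here refl)))))
M⇒P (∨LM d e) δ Δ' s = ∨LP (M⇒P d δ Δ' s) (M⇒P e δ Δ' s)
M⇒P (∨RM {ψ = ψ} d) δ Δ' s =
  ∨-absorbP
    (⊢P⋁-elim {δ = ψ} {Δ' = δ ∷ Δ'} (M⇒P d) (∷⁺ʳ ψ (s ∘ there))
      (∨R₂P (⋁-introP (s (here refl)) (∨R₁P (assumptionP (here refl))))))
    (⋁-introP (s (here refl)) (∨R₂P (assumptionP (here refl))))
M⇒P (⇒LM d e) δ Δ' s =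
  ⊢P⋁-elim (⊢P⋁-weaken there (M⇒P e)) s
    (weakenP swap-⊆
      (⇒LP (weakenP (∷⁺ʳ _ there) (M⇒P d δ Δ' s)) (assumptionP (here refl))))
M⇒P (⇒RpM d) _ _ s =
  ⊢P⋁-elim (M⇒P d) (s ∘ there)
    (⋁-introP (s (here refl)) (⇒RpP (assumptionP (here refl))))
M⇒P (weakM {Δ = Δ} d) δ Δ' s = weakP (M⇒P d δ Δ' (s ∘ xs⊆xs++ys Δ _))
M⇒P (cutM {Γ} {Δ} {Γ₁} d e) δ Δ' s =
  ⊢P⋁-elim (⊢P⋁-weaken (xs⊆xs++ys Γ Γ₁) (M⇒P d)) (s ∘ xs⊆xs++ys Δ _)
    (weakenP (∷⁺ʳ _ (xs⊆ys++xs Γ₁ Γ)) (M⇒P e δ Δ' (s ∘ xs⊆ys++xs _ Δ)))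
M⇒P (setM Γ≈Γ' (Δ⊆Δ' , _) d) δ Δ' s = setP Γ≈Γ' (M⇒P d δ Δ' (s ∘ Δ⊆Δ'))

P⇒M : ∀ {Γ θ} → Γ ⊢P θ → Γ ⊢M (θ ∷ [])
P⇒M axP = axM
P⇒M ⊤P = ⊤M
P⇒M (∧LP d) = ∧LM (P⇒M d)
P⇒M (∧RP d e) = ∧RM (P⇒M d) (P⇒M e)
P⇒M (∨LP d e) = ∨LM (P⇒M d) (P⇒M e)
P⇒M (∨R₁P d) = ∨RM (weakenM ⊆-refl (xs⊆xs++ys _ _) (P⇒M d))
P⇒M (∨R₂P {φ = φ} d) = ∨RM (weakenM ⊆-refl (xs⊆ys++xs _ (φ ∷ [])) (P⇒M d))
P⇒M (⇒LP d e) = ⇒LM (P⇒M d) (weakenM ⊆-refl (xs⊆xs++ys _ _) (P⇒M e))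
P⇒M (⇒RpP d) = ⇒RpM (P⇒M d)
P⇒M (weakP {Γ} {Γ₁} d) = weakenM (xs⊆xs++ys Γ Γ₁) ⊆-refl (P⇒M d)
P⇒M (cutP d e) = setM ≈ₛ-refl (++-identityʳ-≈ₛ _) (cutM (P⇒M d) (P⇒M e))
P⇒M (setP Γ≈Γ' d) = setM Γ≈Γ' ≈ₛ-refl (P⇒M d)

⋁-elimM : ∀ δ Δ → (⋁ δ Δ ∷ []) ⊢M (δ ∷ Δ)
⋁-elimM δ []      = axM
⋁-elimM δ (ψ ∷ Δ) =
  ∨LM (weakenM ⊆-refl (xs⊆xs++ys _ _) axM)
      (weakenM ⊆-refl there (⋁-elimM ψ Δ))

proposition1 : (Γ : List Formula) (δ : Formula) (Δ : List Formula) →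
                 (Γ ⊢P ⋁ δ Δ) ⇔ (Γ ⊢M (δ ∷ Δ))
proposition1 Γ δ Δ = mk⇔
  (λ d → setM (++-identityʳ-≈ₛ Γ) ≈ₛ-refl (cutM (P⇒M d) (⋁-elimM δ Δ)))
  (λ d → M⇒P d δ Δ ⊆-refl)
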